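{- Let $G$ be a finite, simple, connected graph with $res(G)=3$, and let $v\in V(G)$ be a vertex with $\deg(v)=4$. Then the subgraph of $G$ induced by the neighborhood $N(v)$ is a path $P_4$.
   Context: $d$ denotes graph distance; $N(v)$ is the set of neighbors of $v$. For an ordered set $W=\{w_1,\dots,w_k\}\subseteq V(G)$ and $v\in V(G)$, $r(v|W)=(d(v,w_1),\dots,d(v,w_k))$. $W$ is a resolving set if distinct vertices of $G$ have distinct representations with respect to $W$. The resolving number $res(G)$ is the minimum $k$ such that every $k$-subset of $V(G)$ is a resolving set of $G$. -}

module Defs where

open import Data.Nat using (ℕ; zero; suc; _≤_; _<_)
open import Data.Bool using (Bool; true; false)
open import Data.Fin using (Fin)
open import Data.Fin.Subset using (Subset; _∈_; ∣_∣)
open import Data.Vec using (tabulate)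
open import Data.Product using (Σ; ∃; _×_; _,_)
open import Data.Sum using (_⊎_)
open import Relation.Nullary using (¬_)
open import Relation.Binary.PropositionalEquality using (_≡_; _≢_)

-- A finite simple graph on vertex set Fin n: loopless, symmetric,
-- Bool-valued adjacency (so there are no multiple edges).
record Graph : Set where
  field
    n     : ℕ
    adj   : Fin n → Fin n → Bool
    sym   : ∀ u v → adj u v ≡ adj v u
    irrefl : ∀ v → adj v v ≡ false

open Graph public

Adj : (G : Graph) → Fin (n G) → Fin (n G) → Set
Adj G u v = adj G u v ≡ true

data Walk (G : Graph) : Fin (n G) → Fin (n G) → ℕ → Set where
  here : ∀ {u} → Walk G u u zero
  step : ∀ {u w v k} → Adj G u w → Walk G w v k → Walk G u v (suc k)

Connected : Graph → Set
Connected G = ∀ u v → ∃ λ k → Walk G u v k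

Dist : (G : Graph) → Fin (n G) → Fin (n G) → ℕ → Set
Dist G u v k = Walk G u v k × (∀ m → Walk G u v m → k ≤ m)

SameDist : (G : Graph) → Fin (n G) → Fin (n G) → Fin (n G) → Set
SameDist G x y w = ∃ λ k → Dist G x w k × Dist G y w k

-- W is a resolving set: distinct vertices have distinct representations r(.|W).
Resolving : (G : Graph) → Subset (n G) → Set
Resolving G W = ∀ x y → (∀ w → w ∈ W → SameDist G x y w) → x ≡ y

AllResolving : (G : Graph) → ℕ → Set
AllResolving G k = ∀ (W : Subset (n G)) → ∣ W ∣ ≡ k → Resolving G W

ResNumber : Graph → ℕ → Set
ResNumber G r = AllResolving G r × (∀ k → k < r → ¬ AllResolving G k)

N : (G : Graph) → Fin (n G) → Subset (n G)
N G v = tabulate (λ u → adj G v u)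

deg : (G : Graph) → Fin (n G) → ℕ
deg G v = ∣ N G v ∣

-- The subgraph induced by S is (isomorphic to) the path P4:
-- S consists of exactly four distinct vertices a,b,c,d with
-- edges ab, bc, cd and non-edges ac, ad, bd.
InducedP4 : (G : Graph) → Subset (n G) → Set
InducedP4 G S = Σ (Fin (n G)) λ a → Σ (Fin (n G)) λ b → Σ (Fin (n G)) λ c → Σ (Fin (n G)) λ d →
  (a ∈ S × b ∈ S × c ∈ S × d ∈ S)
  × (∀ u → u ∈ S → u ≡ a ⊎ u ≡ b ⊎ u ≡ c ⊎ u ≡ d)
  × (a ≢ b × a ≢ c × a ≢ d × b ≢ c × b ≢ d × c ≢ d)
  × (Adj G a b × Adj G b c × Adj G c d)
  × (¬ Adj G a c × ¬ Adj G a d × ¬ Adj G b d)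

module Submission where

-- Let N(v) = {a, b, c, d} and let x, y be two of these
-- neighbours, z, w the other two.  Then x and y are both at distance 1
-- from v, and at distance 1 or 2 from z according to whether they are
-- adjacent to z (they have the common neighbour v); likewise for w.  As
-- {v, z, w} is a 3-set it resolves x and y, so x and y differ in their
-- adjacency to z or to w: the 4-set N(v) is "separating".
--
-- Its proof looks at the neighbours of a
-- inside {b, c, d}: a cannot see all or none of them, and up to renaming
-- b, c, d it sees exactly b (then the path is a-b-c-d) or exactly b and c
-- (then the path is c-a-b-d).  The theorem is the combination; it only
-- uses that every 3-subset of V(G) is resolving.

open import Defs hiding (sym)
open import Data.Nat using (ℕ; zero; suc; _≤_; z≤n; s≤s)
open import Data.Nat.Properties using (suc-injective; 0≢1+n)
open import Data.Bool using (Bool; true; false)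
open import Data.Fin using (Fin; zero; suc; _≟_)
open import Data.Fin.Subset using (Subset; _∈_; _∉_; ∣_∣; _-_; ⁅_⁆; _∪_; inside; outside)
open import Data.Fin.Subset.Properties
  using (p─q⊆p; x∈p∧x≢y⇒x∈p-y; p─⊥≡p; nonempty?; Empty-unique; ∣⊥∣≡0; ∪-identityˡ; x∈p∪q⁻; x∈⁅y⁆⇒x≡y; ∣⁅x⁆∣≡1)
open import Data.Vec using (_∷_; here; there)
open import Data.Vec.Properties using ([]=⇒lookup; lookup∘tabulate)
open import Data.Product using (∃; _×_; _,_)
open import Data.Sum using (_⊎_; inj₁; inj₂; map₁; map₂; swap; assocˡ; assocʳ)
open import Data.Empty using (⊥; ⊥-elim)
open import Function using (_∘_)
open import Relation.Nullary using (¬_; yes; no)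
open import Relation.Binary.PropositionalEquality using (_≡_; _≢_; refl; sym; trans; cong; subst; ≢-sym)

true≢false : true ≢ false
true≢false ()

⊎-swap₁₂ : ∀ {A B C : Set} → A ⊎ B ⊎ C → B ⊎ A ⊎ C
⊎-swap₁₂ = assocʳ ∘ map₁ swap ∘ assocˡ

x∉p-x : ∀ {m} (x : Fin m) (p : Subset m) → x ∉ p - x
x∉p-x zero    (s ∷ p) ()
x∉p-x (suc x) (s ∷ p) (there x∈p-x) = x∉p-x x p x∈p-x

∈-minus⁻ : ∀ {m} {x y : Fin m} {p : Subset m} → x ∈ p - y → x ∈ p × x ≢ y
∈-minus⁻ {y = y} {p} x∈p-y = p─q⊆p p ⁅ y ⁆ x∈p-y , λ { refl → x∉p-x y p x∈p-y }

∣p∣≡1+∣p-x∣ : ∀ {m} {x : Fin m} {p : Subset m} → x ∈ p → ∣ p ∣ ≡ suc ∣ p - x ∣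
∣p∣≡1+∣p-x∣ {x = zero}  {.inside ∷ p} here = cong (suc ∘ ∣_∣) (sym (p─⊥≡p p))
∣p∣≡1+∣p-x∣ {x = suc x} {inside  ∷ p} (there x∈p) = cong suc (∣p∣≡1+∣p-x∣ x∈p)
∣p∣≡1+∣p-x∣ {x = suc x} {outside ∷ p} (there x∈p) = ∣p∣≡1+∣p-x∣ x∈p

∉-size-0 : ∀ {m} {x : Fin m} {p : Subset m} → ∣ p ∣ ≡ 0 → x ∉ p
∉-size-0 size x∈p = 0≢1+n (trans (sym size) (∣p∣≡1+∣p-x∣ x∈p))

pick : ∀ {m k} (p : Subset m) → ∣ p ∣ ≡ suc k → ∃ λ x → x ∈ p × ∣ p - x ∣ ≡ k
pick {m} p size with nonempty? p
... | yes (x , x∈p) = x , x∈p , suc-injective (trans (sym (∣p∣≡1+∣p-x∣ x∈p)) size)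
... | no empty = ⊥-elim (0≢1+n (trans (sym (∣⊥∣≡0 m)) (trans (cong ∣_∣ (sym (Empty-unique empty))) size)))

record Enumerates {m} (S : Subset m) (a b c d : Fin m) : Set where
  field
    a∈S : a ∈ S
    b∈S : b ∈ S
    c∈S : c ∈ S
    d∈S : d ∈ S
    covers : ∀ u → u ∈ S → u ≡ a ⊎ u ≡ b ⊎ u ≡ c ⊎ u ≡ d
    a≢b : a ≢ b
    a≢c : a ≢ c
    a≢d : a ≢ d
    b≢c : b ≢ c
    b≢d : b ≢ d
    c≢d : c ≢ d

enumerate4 : ∀ {m} (S : Subset m) → ∣ S ∣ ≡ 4 →
  ∃ λ a → ∃ λ b → ∃ λ c → ∃ λ d → Enumerates S a b c d
enumerate4 S size₄ with pick S size₄
... | a , a∈S , size₃ with pick (S - a) size₃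
... | b , b∈S-a , size₂ with pick (S - a - b) size₂
... | c , c∈S-a-b , size₁ with pick (S - a - b - c) size₁
... | d , d∈S-a-b-c , size₀ =
  let (b∈S , b≢a) = ∈-minus⁻ b∈S-a
      (c∈S-a , c≢b) = ∈-minus⁻ c∈S-a-b
      (c∈S , c≢a) = ∈-minus⁻ c∈S-a
      (d∈S-a-b , d≢c) = ∈-minus⁻ d∈S-a-b-c
      (d∈S-a , d≢b) = ∈-minus⁻ d∈S-a-b
      (d∈S , d≢a) = ∈-minus⁻ d∈S-a
  in a , b , c , d , record
    { a∈S = a∈S ; b∈S = b∈S ; c∈S = c∈S ; d∈S = d∈S ; covers = covers
    ; a≢b = ≢-sym b≢a ; a≢c = ≢-sym c≢a ; a≢d = ≢-sym d≢a
    ; b≢c = ≢-sym c≢b ; b≢d = ≢-sym d≢b ; c≢d = ≢-sym d≢c }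
  where
  covers : ∀ u → u ∈ S → u ≡ a ⊎ u ≡ b ⊎ u ≡ c ⊎ u ≡ d
  covers u u∈S with u ≟ a | u ≟ b | u ≟ c | u ≟ d
  ... | yes u≡a | _       | _       | _       = inj₁ u≡a
  ... | no _    | yes u≡b | _       | _       = inj₂ (inj₁ u≡b)
  ... | no _    | no _    | yes u≡c | _       = inj₂ (inj₂ (inj₁ u≡c))
  ... | no _    | no _    | no _    | yes u≡d = inj₂ (inj₂ (inj₂ u≡d))
  ... | no u≢a  | no u≢b  | no u≢c  | no u≢d  =
    ⊥-elim (∉-size-0 size₀ (x∈p∧x≢y⇒x∈p-y (x∈p∧x≢y⇒x∈p-y
      (x∈p∧x≢y⇒x∈p-y (x∈p∧x≢y⇒x∈p-y u∈S u≢a) u≢b) u≢c) u≢d))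

module _ {m} {S : Subset m} {a b c d : Fin m} (F : Enumerates S a b c d) where
  open Enumerates F

  swap₁₂ : Enumerates S b a c d
  swap₁₂ = record
    { a∈S = b∈S ; b∈S = a∈S ; c∈S = c∈S ; d∈S = d∈S
    ; covers = λ u → ⊎-swap₁₂ ∘ covers u
    ; a≢b = ≢-sym a≢b ; a≢c = b≢c ; a≢d = b≢d ; b≢c = a≢c ; b≢d = a≢d ; c≢d = c≢d }

  swap₂₃ : Enumerates S a c b d
  swap₂₃ = record
    { a∈S = a∈S ; b∈S = c∈S ; c∈S = b∈S ; d∈S = d∈S
    ; covers = λ u → map₂ ⊎-swap₁₂ ∘ covers u
    ; a≢b = a≢c ; a≢c = a≢b ; a≢d = a≢d ; b≢c = ≢-sym b≢c ; b≢d = c≢d ; c≢d = b≢d }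

  swap₃₄ : Enumerates S a b d c
  swap₃₄ = record
    { a∈S = a∈S ; b∈S = b∈S ; c∈S = d∈S ; d∈S = c∈S
    ; covers = λ u → map₂ (map₂ swap) ∘ covers u
    ; a≢b = a≢b ; a≢c = a≢d ; a≢d = a≢c ; b≢c = b≢d ; b≢d = b≢c ; c≢d = ≢-sym c≢d }

triple : ∀ {m} → Fin m → Fin m → Fin m → Subset m
triple x y z = ⁅ x ⁆ ∪ (⁅ y ⁆ ∪ ⁅ z ⁆)

∈⁅x⁆∪p⁻ : ∀ {m} {u x : Fin m} {p : Subset m} → u ∈ ⁅ x ⁆ ∪ p → u ≡ x ⊎ u ∈ p
∈⁅x⁆∪p⁻ {x = x} {p} u∈ = map₁ (x∈⁅y⁆⇒x≡y x) (x∈p∪q⁻ ⁅ x ⁆ p u∈)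

∈-triple⁻ : ∀ {m} {u x y z : Fin m} → u ∈ triple x y z → u ≡ x ⊎ u ≡ y ⊎ u ≡ z
∈-triple⁻ {z = z} = map₂ (map₂ (x∈⁅y⁆⇒x≡y z) ∘ ∈⁅x⁆∪p⁻) ∘ ∈⁅x⁆∪p⁻

∣⁅x⁆∪p∣ : ∀ {m} (x : Fin m) (p : Subset m) → x ∉ p → ∣ ⁅ x ⁆ ∪ p ∣ ≡ suc ∣ p ∣
∣⁅x⁆∪p∣ zero    (inside  ∷ p) x∉p = ⊥-elim (x∉p here)
∣⁅x⁆∪p∣ zero    (outside ∷ p) _   = cong (suc ∘ ∣_∣) (∪-identityˡ p)
∣⁅x⁆∪p∣ (suc x) (inside  ∷ p) x∉p = cong suc (∣⁅x⁆∪p∣ x p (x∉p ∘ there))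
∣⁅x⁆∪p∣ (suc x) (outside ∷ p) x∉p = ∣⁅x⁆∪p∣ x p (x∉p ∘ there)

∣triple∣≡3 : ∀ {m} {x y z : Fin m} → x ≢ y → x ≢ z → y ≢ z → ∣ triple x y z ∣ ≡ 3
∣triple∣≡3 {x = x} {y} {z} x≢y x≢z y≢z =
  trans (∣⁅x⁆∪p∣ x (⁅ y ⁆ ∪ ⁅ z ⁆) x∉)
        (cong suc (trans (∣⁅x⁆∪p∣ y ⁅ z ⁆ (y≢z ∘ x∈⁅y⁆⇒x≡y z)) (cong suc (∣⁅x⁆∣≡1 z))))
  where
  x∉ : x ∉ ⁅ y ⁆ ∪ ⁅ z ⁆
  x∉ x∈ with ∈⁅x⁆∪p⁻ x∈
  ... | inj₁ x≡y = x≢y x≡y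
  ... | inj₂ x∈⁅z⁆ = x≢z (x∈⁅y⁆⇒x≡y z x∈⁅z⁆)

module _ (G : Graph) where

  walk₀ : ∀ {x y} → Walk G x y 0 → x ≡ y
  walk₀ here = refl

  walk₁ : ∀ {x y} → Walk G x y 1 → Adj G x y
  walk₁ (step x~y here) = x~y

  adj-sym : ∀ x y → adj G x y ≡ adj G y x
  adj-sym = Graph.sym G

  no-loop : ∀ {x} → ¬ Adj G x x
  no-loop {x} x~x = true≢false (trans (sym x~x) (irrefl G x))

  ¬Adj-of-false : ∀ {x y} → adj G x y ≡ false → ¬ Adj G x y
  ¬Adj-of-false x≁y x~y = true≢false (trans (sym x~y) x≁y)

  dist-adjacent : ∀ {x y} → Adj G x y → Dist G x y 1
  dist-adjacent {x} {y} x~y = step x~y here , shortest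
    where
    shortest : ∀ k → Walk G x y k → 1 ≤ k
    shortest zero    w = ⊥-elim (no-loop (subst (Adj G x) (sym (walk₀ w)) x~y))
    shortest (suc k) _ = s≤s z≤n

  dist-common-neighbour : ∀ {x y u} → x ≢ y → ¬ Adj G x y → Adj G x u → Adj G u y → Dist G x y 2
  dist-common-neighbour {x} {y} x≢y x≁y x~u u~y = step x~u (step u~y here) , shortest
    where
    shortest : ∀ k → Walk G x y k → 2 ≤ k
    shortest zero          w = ⊥-elim (x≢y (walk₀ w))
    shortest (suc zero)    w = ⊥-elim (x≁y (walk₁ w))
    shortest (suc (suc k)) _ = s≤s (s≤s z≤n)

  ∈N⇒Adj : ∀ {v x} → x ∈ N G v → Adj G v x
  ∈N⇒Adj {v} {x} x∈N = trans (sym (lookup∘tabulate (adj G v) x)) ([]=⇒lookup x∈N)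

  ∈N⇒≢ : ∀ {v x} → x ∈ N G v → v ≢ x
  ∈N⇒≢ x∈N refl = no-loop (∈N⇒Adj x∈N)

  neighbour-distance : Bool → ℕ
  neighbour-distance true  = 1
  neighbour-distance false = 2

  dist-in-N : ∀ {v x z} → x ∈ N G v → z ∈ N G v → x ≢ z →
    Dist G x z (neighbour-distance (adj G x z))
  dist-in-N {v} {x} {z} x∈N z∈N x≢z with adj G x z in x~z
  ... | true  = dist-adjacent x~z
  ... | false = dist-common-neighbour x≢z (¬Adj-of-false x~z)
                  (trans (adj-sym x v) (∈N⇒Adj x∈N)) (∈N⇒Adj z∈N)

  same-adj⇒same-dist : ∀ {v x y z} → x ∈ N G v → y ∈ N G v → z ∈ N G v → x ≢ z → y ≢ z →
    adj G x z ≡ adj G y z → SameDist G x y z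
  same-adj⇒same-dist x∈N y∈N z∈N x≢z y≢z xz≡yz =
    neighbour-distance _ , dist-in-N x∈N z∈N x≢z ,
    subst (Dist G _ _ ∘ neighbour-distance) (sym xz≡yz) (dist-in-N y∈N z∈N y≢z)

  same-dist-to-centre : ∀ {v x y} → x ∈ N G v → y ∈ N G v → SameDist G x y v
  same-dist-to-centre {v} {x} {y} x∈N y∈N =
    1 , dist-adjacent (trans (adj-sym x v) (∈N⇒Adj x∈N)) , dist-adjacent (trans (adj-sym y v) (∈N⇒Adj y∈N))

  -- If all 3-sets resolve G, two neighbours x, y of v that are seen equally
  -- by two further neighbours z, w coincide: otherwise {v, z, w} would not
  -- resolve them.
  resolving-separates : AllResolving G 3 → ∀ {v x y z w} →
    x ∈ N G v → y ∈ N G v → z ∈ N G v → w ∈ N G v →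
    z ≢ w → x ≢ z → y ≢ z → x ≢ w → y ≢ w →
    adj G x z ≡ adj G y z → adj G x w ≡ adj G y w → x ≡ y
  resolving-separates every3 {v} {x} {y} {z} {w} x∈N y∈N z∈N w∈N z≢w x≢z y≢z x≢w y≢w xz≡yz xw≡yw =
    every3 (triple v z w) (∣triple∣≡3 (∈N⇒≢ z∈N) (∈N⇒≢ w∈N) z≢w) x y unresolved
    where
    unresolved : ∀ u → u ∈ triple v z w → SameDist G x y u
    unresolved u u∈W with ∈-triple⁻ u∈W
    ... | inj₁ refl        = same-dist-to-centre x∈N y∈N
    ... | inj₂ (inj₁ refl) = same-adj⇒same-dist x∈N y∈N z∈N x≢z y≢z xz≡yz
    ... | inj₂ (inj₂ refl) = same-adj⇒same-dist x∈N y∈N w∈N x≢w y≢w xw≡yw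

  Separating : Subset (n G) → Set
  Separating S = ∀ {a b c d} → Enumerates S a b c d →
    adj G a c ≡ adj G b c → adj G a d ≡ adj G b d → ⊥

  neighbourhood-separating : AllResolving G 3 → ∀ v → Separating (N G v)
  neighbourhood-separating every3 v F ac≡bc ad≡bd =
    a≢b (resolving-separates every3 a∈S b∈S c∈S d∈S c≢d a≢c b≢c a≢d b≢d ac≡bc ad≡bd)
    where open Enumerates F

  induced-path : ∀ {S a b c d} → Enumerates S a b c d →
    adj G a b ≡ true → adj G b c ≡ true → adj G c d ≡ true →
    adj G a c ≡ false → adj G a d ≡ false → adj G b d ≡ false → InducedP4 G S
  induced-path {a = a} {b} {c} {d} F ab bc cd ac ad bd =
    a , b , c , d , (a∈S , b∈S , c∈S , d∈S) , covers , (a≢b , a≢c , a≢d , b≢c , b≢d , c≢d)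
      , (ab , bc , cd) , (¬Adj-of-false ac , ¬Adj-of-false ad , ¬Adj-of-false bd)
    where open Enumerates F

  flip-both : ∀ {x y z w} → adj G x z ≡ adj G y w → adj G z x ≡ adj G w y
  flip-both {x} {y} {z} {w} e = trans (adj-sym z x) (trans e (adj-sym y w))

  flip-right : ∀ {x y z w} → adj G x z ≡ adj G y w → adj G x z ≡ adj G w y
  flip-right {y = y} {w = w} e = trans e (adj-sym y w)

  module _ {S : Subset (n G)} (sep : Separating S) where

    -- Separation of the pairs {b,c}, {b,d}, {c,d} and {a,c} of an
    -- enumeration a, b, c, d, with every adjacency written in enumeration order.
    sep-bc : ∀ {a b c d} → Enumerates S a b c d →
      adj G a b ≡ adj G a c → adj G b d ≡ adj G c d → ⊥
    sep-bc F e₁ e₂ = sep (swap₂₃ (swap₁₂ F)) (flip-both e₁) e₂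

    sep-bd : ∀ {a b c d} → Enumerates S a b c d →
      adj G a b ≡ adj G a d → adj G b c ≡ adj G c d → ⊥
    sep-bd F e₁ e₂ = sep (swap₂₃ (swap₃₄ (swap₁₂ F))) (flip-both e₁) (flip-right e₂)

    sep-cd : ∀ {a b c d} → Enumerates S a b c d →
      adj G a c ≡ adj G a d → adj G b c ≡ adj G b d → ⊥
    sep-cd F e₁ e₂ = sep (swap₂₃ (swap₁₂ (swap₃₄ (swap₂₃ F)))) (flip-both e₁) (flip-both e₂)

    sep-ac : ∀ {a b c d} → Enumerates S a b c d →
      adj G a b ≡ adj G b c → adj G a d ≡ adj G c d → ⊥
    sep-ac F e₁ e₂ = sep (swap₂₃ F) (flip-right e₁) e₂

    -- a cannot be adjacent to all or to none of b, c, d: the adjacencies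
    -- among b, c, d would then be three pairwise distinct Booleans.
    no-uniform-vertex : ∀ {a b c d} → Enumerates S a b c d →
      adj G a b ≡ adj G a c → adj G a c ≡ adj G a d → ⊥
    no-uniform-vertex F ab≡ac ac≡ad =
      three-distinct-Bools (sep-cd F ac≡ad) (sep-bd F (trans ab≡ac ac≡ad)) (sep-bc F ab≡ac)
      where
      three-distinct-Bools : ∀ {x y z : Bool} → x ≢ y → x ≢ z → y ≢ z → ⊥
      three-distinct-Bools {true}  {true}          x≢y _   _   = x≢y refl
      three-distinct-Bools {false} {false}         x≢y _   _   = x≢y refl
      three-distinct-Bools {true}  {false} {true}  _   x≢z _   = x≢z refl
      three-distinct-Bools {true}  {false} {false} _   _   y≢z = y≢z refl
      three-distinct-Bools {false} {true}  {true}  _   _   y≢z = y≢z refl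
      three-distinct-Bools {false} {true}  {false} _   x≢z _   = x≢z refl

    leaf-path : ∀ {a b c d} → Enumerates S a b c d →
      adj G a b ≡ true → adj G a c ≡ false → adj G a d ≡ false → adj G b c ≡ true → InducedP4 G S
    leaf-path {a} {b} {c} {d} F ab ac ad bc with adj G b d in bd | adj G c d in cd
    ... | true  | _     = ⊥-elim (sep-cd F (trans ac (sym ad)) (trans bc (sym bd)))
    ... | false | false = ⊥-elim (sep-ac F (trans ab (sym bc)) (trans ad (sym cd)))
    ... | false | true  = induced-path F ab bc cd ac ad bd

    leaf-case : ∀ {a b c d} → Enumerates S a b c d →
      adj G a b ≡ true → adj G a c ≡ false → adj G a d ≡ false → InducedP4 G S
    leaf-case {a} {b} {c} {d} F ab ac ad with adj G b c in bc | adj G b d in bd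
    ... | true  | _     = leaf-path F ab ac ad bc
    ... | false | true  = leaf-path (swap₃₄ F) ab ad ac bd
    ... | false | false = ⊥-elim (sep-cd F (trans ac (sym ad)) (trans bc (sym bd)))

    inner-path : ∀ {a b c d} → Enumerates S a b c d →
      adj G a b ≡ true → adj G a c ≡ true → adj G a d ≡ false →
      adj G b d ≡ true → adj G c d ≡ false → InducedP4 G S
    inner-path {a} {b} {c} {d} F ab ac ad bd cd with adj G b c in bc
    ... | true  = ⊥-elim (sep-ac F (trans ab (sym bc)) (trans ad (sym cd)))
    ... | false = induced-path (swap₁₂ (swap₂₃ F)) (trans (adj-sym c a) ac) ab bd
                    (trans (adj-sym c b) bc) cd ad

    inner-case : ∀ {a b c d} → Enumerates S a b c d →
      adj G a b ≡ true → adj G a c ≡ true → adj G a d ≡ false → InducedP4 G S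
    inner-case {a} {b} {c} {d} F ab ac ad with adj G b d in bd | adj G c d in cd
    ... | true  | false = inner-path F ab ac ad bd cd
    ... | false | true  = inner-path (swap₂₃ F) ac ab ad cd bd
    ... | true  | true  = ⊥-elim (sep-bc F (trans ab (sym ac)) (trans bd (sym cd)))
    ... | false | false = ⊥-elim (sep-bc F (trans ab (sym ac)) (trans bd (sym cd)))

    separating-induces-P4 : ∀ {a b c d} → Enumerates S a b c d → InducedP4 G S
    separating-induces-P4 {a} {b} {c} {d} F with adj G a b in ab | adj G a c in ac | adj G a d in ad
    ... | true  | false | false = leaf-case F ab ac ad
    ... | false | true  | false = leaf-case (swap₂₃ F) ac ab ad
    ... | false | false | true  = leaf-case (swap₂₃ (swap₃₄ F)) ad ab ac
    ... | true  | true  | false = inner-case F ab ac ad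
    ... | true  | false | true  = inner-case (swap₃₄ F) ab ad ac
    ... | false | true  | true  = inner-case (swap₃₄ (swap₂₃ F)) ac ad ab
    ... | true  | true  | true  = ⊥-elim (no-uniform-vertex F (trans ab (sym ac)) (trans ac (sym ad)))
    ... | false | false | false = ⊥-elim (no-uniform-vertex F (trans ab (sym ac)) (trans ac (sym ad)))

mainTheorem13 : (G : Graph) → Connected G → ResNumber G 3 →
    (v : Fin (n G)) → deg G v ≡ 4 → InducedP4 G (N G v)
mainTheorem13 G _ (every3Resolves , _) v deg≡4 =
  let (_ , _ , _ , _ , enumeration) = enumerate4 (N G v) deg≡4
  in separating-induces-P4 G (neighbourhood-separating G every3Resolves v) enumeration
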